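{- Let $p$ be a prime and $1\le m<p$. For every $n\ge1$ the $q$-integer $[m]$ is invertible in $Z_{p,n}$, and \[\frac{1}{[m]}\equiv[l]_{q^m}\sum_{j=0}^{n-1}\big(-q[\alpha]_{q^p}[p]\big)^j\bmod[p]^n,\] where $l,\alpha$ are the integers with $1\le l<p$, $\alpha\ge0$ and $ml-p\alpha=1$.
   Context: $[n]=[n]_q=(1-q^n)/(1-q)=1+q+\cdots+q^{n-1}$, and $[n]_{x}$ denotes the same expression with $q$ replaced by $x$. $\mathbb{Z}_{(p)}$ is the ring of rationals whose denominator is prime to $p$, and $Z_{p,n}=\mathbb{Z}_{(p)}[q]/([p]^n)$. -}

module Defs where

open import Data.Nat as ℕ using (ℕ; zero; suc)
open import Data.Nat.Divisibility using (_∣_)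
open import Data.Rational as ℚ using (ℚ; 0ℚ; 1ℚ)
open import Data.List using (List; []; _∷_; map)
open import Data.List.Relation.Unary.All using (All)
open import Data.Product using (Σ; _×_; ∃)
open import Relation.Nullary using (¬_)
open import Relation.Binary.PropositionalEquality using (_≡_)

-- Polynomials in q with rational coefficients, as coefficient lists
-- (constant term first). Trailing zeros are allowed; equality of
-- polynomials is coefficientwise (_≈ₚ_).
Poly : Set
Poly = List ℚ

coeff : Poly → ℕ → ℚ
coeff []       _       = 0ℚ
coeff (a ∷ f)  zero    = a
coeff (a ∷ f)  (suc k) = coeff f k

_≈ₚ_ : Poly → Poly → Set
f ≈ₚ g = ∀ k → coeff f k ≡ coeff g k

infixl 6 _+ₚ_ _-ₚ_
infixl 7 _*ₚ_
infixr 8 _^ₚ_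

_+ₚ_ : Poly → Poly → Poly
[]      +ₚ g       = g
(a ∷ f) +ₚ []      = a ∷ f
(a ∷ f) +ₚ (b ∷ g) = (a ℚ.+ b) ∷ (f +ₚ g)

-ₚ_ : Poly → Poly
-ₚ f = map ℚ.-_ f

_-ₚ_ : Poly → Poly → Poly
f -ₚ g = f +ₚ (-ₚ g)

_·ₚ_ : ℚ → Poly → Poly
c ·ₚ f = map (c ℚ.*_) f

_*ₚ_ : Poly → Poly → Poly
[]      *ₚ g = []
(a ∷ f) *ₚ g = (a ·ₚ g) +ₚ (0ℚ ∷ (f *ₚ g))

oneₚ : Poly
oneₚ = 1ℚ ∷ []

_^ₚ_ : Poly → ℕ → Poly
f ^ₚ zero  = oneₚ
f ^ₚ suc n = f *ₚ (f ^ₚ n)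

qpow : ℕ → Poly
qpow zero    = oneₚ
qpow (suc k) = 0ℚ ∷ qpow k

sumₚ : ℕ → (ℕ → Poly) → Poly
sumₚ zero    f = []
sumₚ (suc n) f = sumₚ n f +ₚ f n

qint-at : ℕ → ℕ → Poly
qint-at k n = sumₚ n (λ i → qpow (k ℕ.* i))

qint : ℕ → Poly
qint n = qint-at 1 n

InZ₍_₎ : ℕ → ℚ → Set
InZ₍ p ₎ r = ¬ (p ∣ ℚ.denominatorℕ r)

IsZpPoly : ℕ → Poly → Set
IsZpPoly p f = All (InZ₍ p ₎) f

CongMod : ℕ → Poly → Poly → Poly → Set
CongMod p f g d = Σ Poly λ h → IsZpPoly p h × ((f -ₚ g) ≈ₚ (h *ₚ d))

-- Z_{p,n} = ℤ_(p)[q]/([p]^n)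
Zpn-modulus : ℕ → ℕ → Poly
Zpn-modulus p n = qint p ^ₚ n

InvertibleZpn : ℕ → ℕ → Poly → Set
InvertibleZpn p n f =
  Σ Poly λ u → IsZpPoly p u × CongMod p (u *ₚ f) oneₚ (Zpn-modulus p n)

module Submission where

open import Defs
open import Data.Nat using (ℕ; _≤_; _<_; _+_; _*_)
open import Data.Nat.Primality using (Prime)
open import Data.Product using (_×_)
open import Relation.Binary.PropositionalEquality using (_≡_)

open import Algebra.Bundles using (AbelianGroup; CommutativeRing)
import Algebra.Consequences.Setoid as Consequences
import Algebra.Properties.CommutativeSemigroup as CommutativeSemigroupProperties
import Data.Integer as ℤ
import Data.Integer.Properties as ℤP
open import Data.List using ([]; _∷_; map)
open import Data.List.Relation.Unary.All as All using ([]; _∷_)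
open import Data.List.Relation.Unary.All.Properties using (map⁺)
open import Data.Nat using (zero; suc)
open import Data.Nat.Divisibility using (_∣_; divides; ∣-trans; ∣1⇒≡1)
open import Data.Nat.Primality using (¬prime[1]; euclidsLemma)
import Data.Nat.Properties as ℕP
open import Data.Product using (_,_)
open import Data.Rational as ℚ using (ℚ; 0ℚ; 1ℚ)
import Data.Rational.Properties as ℚP
open import Data.Sum using ([_,_]′)
open import Level using (0ℓ)
open import Relation.Binary.Bundles using (Setoid)
open import Relation.Binary.PropositionalEquality using (refl; sym; trans; cong; cong₂; subst; module ≡-Reasoning)
import Relation.Binary.Reasoning.Setoid as SetoidReasoning

-- Put t = q[α]_{q^p}[p]. Since [a][b]_{q^a} = [ab] and [x + y] = [x] + q^x[y], the relation
-- m l = p α + 1 gives [m][l]_{q^m} = [1 + p α] = 1 + q[pα] = 1 + t. Multiplying the telescoping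
-- identity (1 + t) Σ_{j<n} (-t)^j = 1 - (-t)^n by [l]_{q^m} shows that [m] times the proposed
-- inverse is 1 - (-q[α]_{q^p})^n [p]^n, i.e. 1 modulo [p]^n. The inverse and the cofactor are
-- built from q and ±1 by ring operations, and ℤ_(p) is a subring of ℚ (closure under + and ·
-- is Euclid's lemma applied to denominators), so both lie in ℤ_(p)[q].

infix 4 _≋_

-- A record rather than _≈ₚ_ itself, so that both polynomials can be inferred from an equation.
record _≋_ (f g : Poly) : Set where
  constructor coeffwise
  field coeff-≡ : f ≈ₚ g

private variable
  a b : ℚ
  f f′ g g′ : Poly

≋-refl : f ≋ f
≋-refl = coeffwise λ _ → refl

≋-sym : f ≋ g → g ≋ f
≋-sym (coeffwise e) = coeffwise λ k → sym (e k)

≋-trans : ∀ {f g h} → f ≋ g → g ≋ h → f ≋ h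
≋-trans (coeffwise e) (coeffwise e′) = coeffwise λ k → trans (e k) (e′ k)

≋-setoid : Setoid 0ℓ 0ℓ
≋-setoid = record
  { _≈_ = _≋_
  ; isEquivalence = record { refl = ≋-refl ; sym = ≋-sym ; trans = ≋-trans }
  }

∷-cong : a ≡ b → f ≋ g → (a ∷ f) ≋ (b ∷ g)
∷-cong a≡b (coeffwise e) = coeffwise λ { zero → a≡b ; (suc k) → e k }

0∷[]≋[] : (0ℚ ∷ []) ≋ []
0∷[]≋[] = coeffwise λ { zero → refl ; (suc k) → refl }

coeff-+ : ∀ f g k → coeff (f +ₚ g) k ≡ coeff f k ℚ.+ coeff g k
coeff-+ []      g       k       = sym (ℚP.+-identityˡ (coeff g k))
coeff-+ (a ∷ f) []      k       = sym (ℚP.+-identityʳ (coeff (a ∷ f) k))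
coeff-+ (a ∷ f) (b ∷ g) zero    = refl
coeff-+ (a ∷ f) (b ∷ g) (suc k) = coeff-+ f g k

coeff-map : ∀ (t : ℚ → ℚ) → t 0ℚ ≡ 0ℚ → ∀ f k → coeff (map t f) k ≡ t (coeff f k)
coeff-map t t0≡0 []      k       = sym t0≡0
coeff-map t t0≡0 (a ∷ f) zero    = refl
coeff-map t t0≡0 (a ∷ f) (suc k) = coeff-map t t0≡0 f k

coeff-neg : ∀ f k → coeff (-ₚ f) k ≡ ℚ.- coeff f k
coeff-neg = coeff-map ℚ.-_ refl

coeff-· : ∀ c f k → coeff (c ·ₚ f) k ≡ c ℚ.* coeff f k
coeff-· c = coeff-map (c ℚ.*_) (ℚP.*-zeroʳ c)

module _ where
  open ≡-Reasoning

  +ₚ-cong : f ≋ f′ → g ≋ g′ → f +ₚ g ≋ f′ +ₚ g′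
  +ₚ-cong {f} {f′} {g} {g′} (coeffwise e) (coeffwise e′) = coeffwise λ k → begin
    coeff (f +ₚ g) k            ≡⟨ coeff-+ f g k ⟩
    coeff f k ℚ.+ coeff g k     ≡⟨ cong₂ ℚ._+_ (e k) (e′ k) ⟩
    coeff f′ k ℚ.+ coeff g′ k   ≡⟨ coeff-+ f′ g′ k ⟨
    coeff (f′ +ₚ g′) k          ∎

  +ₚ-assoc : ∀ f g h → (f +ₚ g) +ₚ h ≋ f +ₚ (g +ₚ h)
  +ₚ-assoc f g h = coeffwise λ k → begin
    coeff ((f +ₚ g) +ₚ h) k                    ≡⟨ coeff-+ (f +ₚ g) h k ⟩
    coeff (f +ₚ g) k ℚ.+ coeff h k             ≡⟨ cong (ℚ._+ coeff h k) (coeff-+ f g k) ⟩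
    (coeff f k ℚ.+ coeff g k) ℚ.+ coeff h k    ≡⟨ ℚP.+-assoc (coeff f k) (coeff g k) (coeff h k) ⟩
    coeff f k ℚ.+ (coeff g k ℚ.+ coeff h k)    ≡⟨ cong (coeff f k ℚ.+_) (coeff-+ g h k) ⟨
    coeff f k ℚ.+ coeff (g +ₚ h) k             ≡⟨ coeff-+ f (g +ₚ h) k ⟨
    coeff (f +ₚ (g +ₚ h)) k                    ∎

  +ₚ-comm : ∀ f g → f +ₚ g ≋ g +ₚ f
  +ₚ-comm f g = coeffwise λ k → begin
    coeff (f +ₚ g) k         ≡⟨ coeff-+ f g k ⟩
    coeff f k ℚ.+ coeff g k  ≡⟨ ℚP.+-comm (coeff f k) (coeff g k) ⟩
    coeff g k ℚ.+ coeff f k  ≡⟨ coeff-+ g f k ⟨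
    coeff (g +ₚ f) k         ∎

  -ₚ-cong : f ≋ g → -ₚ f ≋ -ₚ g
  -ₚ-cong {f} {g} (coeffwise e) = coeffwise λ k → begin
    coeff (-ₚ f) k   ≡⟨ coeff-neg f k ⟩
    ℚ.- coeff f k    ≡⟨ cong ℚ.-_ (e k) ⟩
    ℚ.- coeff g k    ≡⟨ coeff-neg g k ⟨
    coeff (-ₚ g) k   ∎

  -ₚ-inverseʳ : ∀ f → f +ₚ (-ₚ f) ≋ []
  -ₚ-inverseʳ f = coeffwise λ k → begin
    coeff (f +ₚ (-ₚ f)) k             ≡⟨ coeff-+ f (-ₚ f) k ⟩
    coeff f k ℚ.+ coeff (-ₚ f) k      ≡⟨ cong (coeff f k ℚ.+_) (coeff-neg f k) ⟩
    coeff f k ℚ.+ ℚ.- coeff f k       ≡⟨ ℚP.+-inverseʳ (coeff f k) ⟩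
    0ℚ                                ∎

  ·ₚ-congʳ : ∀ c → f ≋ g → c ·ₚ f ≋ c ·ₚ g
  ·ₚ-congʳ {f} {g} c (coeffwise e) = coeffwise λ k → begin
    coeff (c ·ₚ f) k   ≡⟨ coeff-· c f k ⟩
    c ℚ.* coeff f k    ≡⟨ cong (c ℚ.*_) (e k) ⟩
    c ℚ.* coeff g k    ≡⟨ coeff-· c g k ⟨
    coeff (c ·ₚ g) k   ∎

  ·ₚ-distribˡ : ∀ c f g → c ·ₚ (f +ₚ g) ≋ c ·ₚ f +ₚ c ·ₚ g
  ·ₚ-distribˡ c f g = coeffwise λ k → begin
    coeff (c ·ₚ (f +ₚ g)) k                    ≡⟨ coeff-· c (f +ₚ g) k ⟩
    c ℚ.* coeff (f +ₚ g) k                     ≡⟨ cong (c ℚ.*_) (coeff-+ f g k) ⟩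
    c ℚ.* (coeff f k ℚ.+ coeff g k)            ≡⟨ ℚP.*-distribˡ-+ c (coeff f k) (coeff g k) ⟩
    c ℚ.* coeff f k ℚ.+ c ℚ.* coeff g k        ≡⟨ cong₂ ℚ._+_ (coeff-· c f k) (coeff-· c g k) ⟨
    coeff (c ·ₚ f) k ℚ.+ coeff (c ·ₚ g) k      ≡⟨ coeff-+ (c ·ₚ f) (c ·ₚ g) k ⟨
    coeff (c ·ₚ f +ₚ c ·ₚ g) k                 ∎

  ·ₚ-assoc : ∀ a b f → a ·ₚ (b ·ₚ f) ≋ (a ℚ.* b) ·ₚ f
  ·ₚ-assoc a b f = coeffwise λ k → begin
    coeff (a ·ₚ (b ·ₚ f)) k      ≡⟨ coeff-· a (b ·ₚ f) k ⟩
    a ℚ.* coeff (b ·ₚ f) k       ≡⟨ cong (a ℚ.*_) (coeff-· b f k) ⟩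
    a ℚ.* (b ℚ.* coeff f k)      ≡⟨ ℚP.*-assoc a b (coeff f k) ⟨
    (a ℚ.* b) ℚ.* coeff f k      ≡⟨ coeff-· (a ℚ.* b) f k ⟨
    coeff ((a ℚ.* b) ·ₚ f) k     ∎

  ·ₚ-identityˡ : ∀ f → 1ℚ ·ₚ f ≋ f
  ·ₚ-identityˡ f = coeffwise λ k → trans (coeff-· 1ℚ f k) (ℚP.*-identityˡ (coeff f k))

  ·ₚ-zeroˡ : ∀ f → 0ℚ ·ₚ f ≋ []
  ·ₚ-zeroˡ f = coeffwise λ k → trans (coeff-· 0ℚ f k) (ℚP.*-zeroˡ (coeff f k))

+ₚ-congˡ : ∀ f → g ≋ g′ → f +ₚ g ≋ f +ₚ g′
+ₚ-congˡ f = +ₚ-cong (≋-refl {f})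

+ₚ-congʳ : ∀ g → f ≋ f′ → f +ₚ g ≋ f′ +ₚ g
+ₚ-congʳ g f≋f′ = +ₚ-cong f≋f′ (≋-refl {g})

+ₚ-abelianGroup : AbelianGroup 0ℓ 0ℓ
+ₚ-abelianGroup = record
  { Carrier = Poly
  ; _≈_ = _≋_
  ; _∙_ = _+ₚ_
  ; ε = []
  ; _⁻¹ = -ₚ_
  ; isAbelianGroup = record
    { isGroup = record
      { isMonoid = record
        { isSemigroup = record
          { isMagma = record { isEquivalence = Setoid.isEquivalence ≋-setoid ; ∙-cong = +ₚ-cong }
          ; assoc = +ₚ-assoc
          }
        ; identity = comm∧idˡ⇒id +ₚ-comm (λ _ → ≋-refl)
        }
      ; inverse = comm∧invʳ⇒inv +ₚ-comm -ₚ-inverseʳ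
      ; ⁻¹-cong = -ₚ-cong
      }
    ; comm = +ₚ-comm
    }
  }
  where open Consequences ≋-setoid

private module +ₚ = CommutativeSemigroupProperties (AbelianGroup.commutativeSemigroup +ₚ-abelianGroup)

·ₚ-shift : ∀ c f → c ·ₚ (0ℚ ∷ f) ≋ 0ℚ ∷ (c ·ₚ f)
·ₚ-shift c f = ∷-cong (ℚP.*-zeroʳ c) ≋-refl

*ₚ-shiftˡ : ∀ f g → (0ℚ ∷ f) *ₚ g ≋ 0ℚ ∷ f *ₚ g
*ₚ-shiftˡ f g = +ₚ-cong (·ₚ-zeroˡ g) ≋-refl

*ₚ-congʳ : ∀ f → g ≋ g′ → f *ₚ g ≋ f *ₚ g′
*ₚ-congʳ []      g≋g′ = ≋-refl
*ₚ-congʳ (a ∷ f) g≋g′ = +ₚ-cong (·ₚ-congʳ a g≋g′) (∷-cong refl (*ₚ-congʳ f g≋g′))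

*ₚ-zeroʳ : ∀ f → f *ₚ [] ≋ []
*ₚ-zeroʳ []      = ≋-refl
*ₚ-zeroʳ (a ∷ f) = ≋-trans (∷-cong refl (*ₚ-zeroʳ f)) 0∷[]≋[]

*ₚ-∷ʳ : ∀ f b g → f *ₚ (b ∷ g) ≋ b ·ₚ f +ₚ (0ℚ ∷ f *ₚ g)
*ₚ-∷ʳ []      b g = ≋-sym 0∷[]≋[]
*ₚ-∷ʳ (a ∷ f) b g = ∷-cong (cong (ℚ._+ 0ℚ) (ℚP.*-comm a b)) (begin
  a ·ₚ g +ₚ f *ₚ (b ∷ g)                  ≈⟨ +ₚ-congˡ (a ·ₚ g) (*ₚ-∷ʳ f b g) ⟩
  a ·ₚ g +ₚ (b ·ₚ f +ₚ (0ℚ ∷ f *ₚ g))     ≈⟨ +ₚ.x∙yz≈y∙xz (a ·ₚ g) (b ·ₚ f) _ ⟩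
  b ·ₚ f +ₚ (a ·ₚ g +ₚ (0ℚ ∷ f *ₚ g))     ∎)
  where open SetoidReasoning ≋-setoid

*ₚ-comm : ∀ f g → f *ₚ g ≋ g *ₚ f
*ₚ-comm []      g = ≋-sym (*ₚ-zeroʳ g)
*ₚ-comm (a ∷ f) g = ≋-trans (+ₚ-congˡ (a ·ₚ g) (∷-cong refl (*ₚ-comm f g))) (≋-sym (*ₚ-∷ʳ g a f))

*ₚ-congˡ : ∀ g → f ≋ f′ → f *ₚ g ≋ f′ *ₚ g
*ₚ-congˡ {f} {f′} g f≋f′ = ≋-trans (*ₚ-comm f g) (≋-trans (*ₚ-congʳ g f≋f′) (*ₚ-comm g f′))

*ₚ-distribˡ : ∀ f g h → f *ₚ (g +ₚ h) ≋ f *ₚ g +ₚ f *ₚ h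
*ₚ-distribˡ []      g h = ≋-refl
*ₚ-distribˡ (a ∷ f) g h = begin
  a ·ₚ (g +ₚ h) +ₚ (0ℚ ∷ f *ₚ (g +ₚ h))
    ≈⟨ +ₚ-cong (·ₚ-distribˡ a g h) (∷-cong refl (*ₚ-distribˡ f g h)) ⟩
  (a ·ₚ g +ₚ a ·ₚ h) +ₚ ((0ℚ ∷ f *ₚ g) +ₚ (0ℚ ∷ f *ₚ h))
    ≈⟨ +ₚ.interchange (a ·ₚ g) (a ·ₚ h) _ _ ⟩
  (a ·ₚ g +ₚ (0ℚ ∷ f *ₚ g)) +ₚ (a ·ₚ h +ₚ (0ℚ ∷ f *ₚ h))
    ∎
  where open SetoidReasoning ≋-setoid

·ₚ-*ₚ : ∀ c f g → (c ·ₚ f) *ₚ g ≋ c ·ₚ (f *ₚ g)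
·ₚ-*ₚ c []      g = ≋-refl
·ₚ-*ₚ c (b ∷ f) g = begin
  (c ℚ.* b) ·ₚ g +ₚ (0ℚ ∷ (c ·ₚ f) *ₚ g)   ≈⟨ +ₚ-cong (≋-sym (·ₚ-assoc c b g)) (∷-cong refl (·ₚ-*ₚ c f g)) ⟩
  c ·ₚ (b ·ₚ g) +ₚ (0ℚ ∷ c ·ₚ (f *ₚ g))    ≈⟨ +ₚ-congˡ (c ·ₚ (b ·ₚ g)) (·ₚ-shift c (f *ₚ g)) ⟨
  c ·ₚ (b ·ₚ g) +ₚ c ·ₚ (0ℚ ∷ f *ₚ g)      ≈⟨ ·ₚ-distribˡ c (b ·ₚ g) _ ⟨
  c ·ₚ (b ·ₚ g +ₚ (0ℚ ∷ f *ₚ g))           ∎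
  where open SetoidReasoning ≋-setoid

*ₚ-assoc : ∀ f g h → (f *ₚ g) *ₚ h ≋ f *ₚ (g *ₚ h)
*ₚ-assoc []      g h = ≋-refl
*ₚ-assoc (a ∷ f) g h = begin
  (a ·ₚ g +ₚ (0ℚ ∷ f *ₚ g)) *ₚ h              ≈⟨ *ₚ-comm _ h ⟩
  h *ₚ (a ·ₚ g +ₚ (0ℚ ∷ f *ₚ g))              ≈⟨ *ₚ-distribˡ h (a ·ₚ g) _ ⟩
  h *ₚ (a ·ₚ g) +ₚ h *ₚ (0ℚ ∷ f *ₚ g)         ≈⟨ +ₚ-cong (*ₚ-comm h (a ·ₚ g)) (*ₚ-comm h _) ⟩
  (a ·ₚ g) *ₚ h +ₚ (0ℚ ∷ f *ₚ g) *ₚ h         ≈⟨ +ₚ-cong (·ₚ-*ₚ a g h) (≋-trans (*ₚ-shiftˡ (f *ₚ g) h) (∷-cong refl (*ₚ-assoc f g h))) ⟩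
  a ·ₚ (g *ₚ h) +ₚ (0ℚ ∷ f *ₚ (g *ₚ h))       ∎
  where open SetoidReasoning ≋-setoid

*ₚ-identityˡ : ∀ f → oneₚ *ₚ f ≋ f
*ₚ-identityˡ f = ≋-trans (+ₚ-cong (·ₚ-identityˡ f) 0∷[]≋[]) (AbelianGroup.identityʳ +ₚ-abelianGroup f)

Poly-commutativeRing : CommutativeRing 0ℓ 0ℓ
Poly-commutativeRing = record
  { _+_ = _+ₚ_
  ; _*_ = _*ₚ_
  ; -_ = -ₚ_
  ; 0# = []
  ; 1# = oneₚ
  ; isCommutativeRing = record
    { isRing = record
      { +-isAbelianGroup = AbelianGroup.isAbelianGroup +ₚ-abelianGroup
      ; *-cong = λ {f} {f′} {g} f≋f′ g≋g′ → ≋-trans (*ₚ-congˡ g f≋f′) (*ₚ-congʳ f′ g≋g′)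
      ; *-assoc = *ₚ-assoc
      ; *-identity = comm∧idˡ⇒id *ₚ-comm *ₚ-identityˡ
      ; distrib = comm∧distrˡ⇒distr +ₚ-cong *ₚ-comm *ₚ-distribˡ
      }
    ; *-comm = *ₚ-comm
    }
  }
  where open Consequences ≋-setoid

module P = CommutativeRing Poly-commutativeRing
open import Algebra.Properties.Ring P.ring using (-‿distribˡ-*)
open import Algebra.Properties.Group P.+-group using (inverseˡ-unique)
open import Algebra.Properties.Semiring.Exp P.semiring using (_^_; ^-congˡ)
open import Algebra.Properties.CommutativeSemiring.Exp P.commutativeSemiring using (^-distrib-*)
private module *ₚ = CommutativeSemigroupProperties P.*-commutativeSemigroup

^ₚ≡^ : ∀ f n → f ^ₚ n ≡ f ^ n
^ₚ≡^ f zero    = refl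
^ₚ≡^ f (suc n) = cong (f *ₚ_) (^ₚ≡^ f n)

≡⇒≋ : f ≡ g → f ≋ g
≡⇒≋ refl = ≋-refl

qpow-+ : ∀ i j → qpow (i + j) ≋ qpow i *ₚ qpow j
qpow-+ zero    j = ≋-sym (P.*-identityˡ (qpow j))
qpow-+ (suc i) j = ≋-trans (∷-cong refl (qpow-+ i j)) (≋-sym (*ₚ-shiftˡ (qpow i) (qpow j)))

qint-at-+ : ∀ k x y → qint-at k (x + y) ≋ qint-at k x +ₚ qpow (k * x) *ₚ qint-at k y
qint-at-+ k x zero = begin
  qint-at k (x + 0)                            ≡⟨ cong (qint-at k) (ℕP.+-identityʳ x) ⟩
  qint-at k x                                  ≈⟨ P.+-identityʳ (qint-at k x) ⟨
  qint-at k x +ₚ []                            ≈⟨ +ₚ-congˡ (qint-at k x) (P.zeroʳ (qpow (k * x))) ⟨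
  qint-at k x +ₚ qpow (k * x) *ₚ []            ∎
  where open SetoidReasoning ≋-setoid
qint-at-+ k x (suc y) = begin
  qint-at k (x + suc y)
    ≡⟨ cong (qint-at k) (ℕP.+-suc x y) ⟩
  qint-at k (x + y) +ₚ qpow (k * (x + y))
    ≈⟨ +ₚ-cong (qint-at-+ k x y) (≋-trans (≡⇒≋ (cong qpow (ℕP.*-distribˡ-+ k x y))) (qpow-+ (k * x) (k * y))) ⟩
  (qint-at k x +ₚ qpow (k * x) *ₚ qint-at k y) +ₚ qpow (k * x) *ₚ qpow (k * y)
    ≈⟨ P.+-assoc (qint-at k x) _ _ ⟩
  qint-at k x +ₚ (qpow (k * x) *ₚ qint-at k y +ₚ qpow (k * x) *ₚ qpow (k * y))
    ≈⟨ +ₚ-congˡ (qint-at k x) (P.distribˡ (qpow (k * x)) (qint-at k y) (qpow (k * y))) ⟨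
  qint-at k x +ₚ qpow (k * x) *ₚ (qint-at k y +ₚ qpow (k * y))
    ∎
  where open SetoidReasoning ≋-setoid

qint-at-* : ∀ k a b → qint-at k a *ₚ qint-at (k * a) b ≋ qint-at k (a * b)
qint-at-* k a zero = begin
  qint-at k a *ₚ []     ≈⟨ P.zeroʳ (qint-at k a) ⟩
  []                    ≡⟨ cong (qint-at k) (ℕP.*-zeroʳ a) ⟨
  qint-at k (a * 0)     ∎
  where open SetoidReasoning ≋-setoid
qint-at-* k a (suc b) = begin
  qint-at k a *ₚ (qint-at (k * a) b +ₚ qpow (k * a * b))
    ≈⟨ P.distribˡ (qint-at k a) _ _ ⟩
  qint-at k a *ₚ qint-at (k * a) b +ₚ qint-at k a *ₚ qpow (k * a * b)
    ≈⟨ +ₚ-cong (qint-at-* k a b) (P.*-comm (qint-at k a) _) ⟩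
  qint-at k (a * b) +ₚ qpow (k * a * b) *ₚ qint-at k a
    ≡⟨ cong (λ e → qint-at k (a * b) +ₚ qpow e *ₚ qint-at k a) (ℕP.*-assoc k a b) ⟩
  qint-at k (a * b) +ₚ qpow (k * (a * b)) *ₚ qint-at k a
    ≈⟨ qint-at-+ k (a * b) a ⟨
  qint-at k (a * b + a)
    ≡⟨ cong (qint-at k) (trans (ℕP.+-comm (a * b) a) (sym (ℕP.*-suc a b))) ⟩
  qint-at k (a * suc b)
    ∎
  where open SetoidReasoning ≋-setoid

m*l≡p*α+1⇒[m][l]≋1+q[α][p] : ∀ p m l α → m * l ≡ p * α + 1
  → qint m *ₚ qint-at m l ≋ oneₚ +ₚ qpow 1 *ₚ qint-at p α *ₚ qint p
m*l≡p*α+1⇒[m][l]≋1+q[α][p] p m l α ml≡pα+1 = begin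
  qint m *ₚ qint-at m l                          ≡⟨ cong (λ k → qint m *ₚ qint-at k l) (ℕP.*-identityˡ m) ⟨
  qint m *ₚ qint-at (1 * m) l                    ≈⟨ qint-at-* 1 m l ⟩
  qint (m * l)                                   ≡⟨ cong qint (trans ml≡pα+1 (ℕP.+-comm (p * α) 1)) ⟩
  qint (1 + p * α)                               ≈⟨ qint-at-+ 1 1 (p * α) ⟩
  oneₚ +ₚ qpow 1 *ₚ qint (p * α)                 ≈⟨ +ₚ-congˡ oneₚ (*ₚ-congʳ (qpow 1) (qint-at-* 1 p α)) ⟨
  oneₚ +ₚ qpow 1 *ₚ (qint p *ₚ qint-at (1 * p) α) ≡⟨ cong (λ k → oneₚ +ₚ qpow 1 *ₚ (qint p *ₚ qint-at k α)) (ℕP.*-identityˡ p) ⟩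
  oneₚ +ₚ qpow 1 *ₚ (qint p *ₚ qint-at p α)      ≈⟨ +ₚ-congˡ oneₚ (*ₚ.x∙yz≈xz∙y (qpow 1) (qint p) (qint-at p α)) ⟩
  oneₚ +ₚ qpow 1 *ₚ qint-at p α *ₚ qint p        ∎
  where open SetoidReasoning ≋-setoid

geometric-sum : ∀ t n → (oneₚ +ₚ t) *ₚ sumₚ n (λ j → (-ₚ t) ^ₚ j) +ₚ (-ₚ t) ^ₚ n ≋ oneₚ
geometric-sum t zero    = +ₚ-congʳ oneₚ (P.zeroʳ (oneₚ +ₚ t))
geometric-sum t (suc n) = begin
  (oneₚ +ₚ t) *ₚ (S +ₚ y) +ₚ (-ₚ t) *ₚ y           ≈⟨ +ₚ-congʳ ((-ₚ t) *ₚ y) (P.distribˡ (oneₚ +ₚ t) S y) ⟩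
  ((oneₚ +ₚ t) *ₚ S +ₚ (oneₚ +ₚ t) *ₚ y) +ₚ (-ₚ t) *ₚ y
                                                    ≈⟨ P.+-assoc ((oneₚ +ₚ t) *ₚ S) _ _ ⟩
  (oneₚ +ₚ t) *ₚ S +ₚ ((oneₚ +ₚ t) *ₚ y +ₚ (-ₚ t) *ₚ y)
                                                    ≈⟨ +ₚ-congˡ ((oneₚ +ₚ t) *ₚ S) (P.distribʳ y (oneₚ +ₚ t) (-ₚ t)) ⟨
  (oneₚ +ₚ t) *ₚ S +ₚ ((oneₚ +ₚ t) +ₚ (-ₚ t)) *ₚ y  ≈⟨ +ₚ-congˡ ((oneₚ +ₚ t) *ₚ S) (*ₚ-congˡ y 1+t-t≋1) ⟩
  (oneₚ +ₚ t) *ₚ S +ₚ oneₚ *ₚ y                     ≈⟨ +ₚ-congˡ ((oneₚ +ₚ t) *ₚ S) (P.*-identityˡ y) ⟩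
  (oneₚ +ₚ t) *ₚ S +ₚ y                             ≈⟨ geometric-sum t n ⟩
  oneₚ                                              ∎
  where
  open SetoidReasoning ≋-setoid
  S y : Poly
  S = sumₚ n (λ j → (-ₚ t) ^ₚ j)
  y = (-ₚ t) ^ₚ n
  1+t-t≋1 : (oneₚ +ₚ t) +ₚ (-ₚ t) ≋ oneₚ
  1+t-t≋1 = ≋-trans (P.+-assoc oneₚ t (-ₚ t)) (≋-trans (+ₚ-congˡ oneₚ (P.-‿inverseʳ t)) (P.+-identityʳ oneₚ))

^ₚ-congˡ : ∀ n → f ≋ g → f ^ₚ n ≋ g ^ₚ n
^ₚ-congˡ {f} {g} n f≋g = begin
  f ^ₚ n   ≡⟨ ^ₚ≡^ f n ⟩
  f ^ n    ≈⟨ ^-congˡ n f≋g ⟩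
  g ^ n    ≡⟨ ^ₚ≡^ g n ⟨
  g ^ₚ n   ∎
  where open SetoidReasoning ≋-setoid

^ₚ-distrib-*ₚ : ∀ f g n → (f *ₚ g) ^ₚ n ≋ f ^ₚ n *ₚ g ^ₚ n
^ₚ-distrib-*ₚ f g n = begin
  (f *ₚ g) ^ₚ n       ≡⟨ ^ₚ≡^ (f *ₚ g) n ⟩
  (f *ₚ g) ^ n        ≈⟨ ^-distrib-* f g n ⟩
  f ^ n *ₚ g ^ n      ≡⟨ cong₂ _*ₚ_ (^ₚ≡^ f n) (^ₚ≡^ g n) ⟨
  f ^ₚ n *ₚ g ^ₚ n    ∎
  where open SetoidReasoning ≋-setoid

x+y≋1⇒x-1≋-y : ∀ x y → x +ₚ y ≋ oneₚ → x -ₚ oneₚ ≋ -ₚ y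
x+y≋1⇒x-1≋-y x y x+y≋1 = inverseˡ-unique (x -ₚ oneₚ) y (begin
  (x -ₚ oneₚ) +ₚ y      ≈⟨ +ₚ.xy∙z≈xz∙y x (-ₚ oneₚ) y ⟩
  (x +ₚ y) -ₚ oneₚ      ≈⟨ +ₚ-congʳ (-ₚ oneₚ) x+y≋1 ⟩
  oneₚ -ₚ oneₚ          ≈⟨ P.-‿inverseʳ oneₚ ⟩
  []                    ∎)
  where open SetoidReasoning ≋-setoid

inverse-mod-power : ∀ x L w P n → x *ₚ L ≋ oneₚ +ₚ w *ₚ P
  → x *ₚ (L *ₚ sumₚ n (λ j → (-ₚ (w *ₚ P)) ^ₚ j)) -ₚ oneₚ ≋ -ₚ ((-ₚ w) ^ₚ n) *ₚ P ^ₚ n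
inverse-mod-power x L w P n xL≋1+wP = begin
  x *ₚ (L *ₚ S) -ₚ oneₚ                 ≈⟨ +ₚ-congʳ (-ₚ oneₚ) (≋-trans (≋-sym (P.*-assoc x L S)) (*ₚ-congˡ S xL≋1+wP)) ⟩
  (oneₚ +ₚ w *ₚ P) *ₚ S -ₚ oneₚ         ≈⟨ x+y≋1⇒x-1≋-y _ _ (geometric-sum (w *ₚ P) n) ⟩
  -ₚ ((-ₚ (w *ₚ P)) ^ₚ n)               ≈⟨ -ₚ-cong (^ₚ-congˡ n (-‿distribˡ-* w P)) ⟩
  -ₚ (((-ₚ w) *ₚ P) ^ₚ n)               ≈⟨ -ₚ-cong (^ₚ-distrib-*ₚ (-ₚ w) P n) ⟩
  -ₚ ((-ₚ w) ^ₚ n *ₚ P ^ₚ n)            ≈⟨ -‿distribˡ-* ((-ₚ w) ^ₚ n) (P ^ₚ n) ⟩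
  -ₚ ((-ₚ w) ^ₚ n) *ₚ P ^ₚ n            ∎
  where
  open SetoidReasoning ≋-setoid
  S : Poly
  S = sumₚ n (λ j → (-ₚ (w *ₚ P)) ^ₚ j)

↧ₙ-∣ : ∀ r {x y} → ℚ.denominator r ℤ.* x ≡ y → ℚ.denominatorℕ r ∣ ℤ.∣ y ∣
↧ₙ-∣ r {x} refl = divides ℤ.∣ x ∣ (trans (ℤP.abs-* (ℚ.denominator r) x) (ℕP.*-comm _ ℤ.∣ x ∣))

↧ₙ-+-∣ : ∀ a b → ℚ.denominatorℕ (a ℚ.+ b) ∣ ℚ.denominatorℕ a * ℚ.denominatorℕ b
↧ₙ-+-∣ a b = subst (ℚ.denominatorℕ (a ℚ.+ b) ∣_) (ℤP.abs-* (ℚ.denominator a) (ℚ.denominator b)) (↧ₙ-∣ (a ℚ.+ b) (ℚP.↧-+ a b))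

↧ₙ-*-∣ : ∀ a b → ℚ.denominatorℕ (a ℚ.* b) ∣ ℚ.denominatorℕ a * ℚ.denominatorℕ b
↧ₙ-*-∣ a b = subst (ℚ.denominatorℕ (a ℚ.* b) ∣_) (ℤP.abs-* (ℚ.denominator a) (ℚ.denominator b)) (↧ₙ-∣ (a ℚ.* b) (ℚP.↧-* a b))

module ℤ₍ₚ₎-Closure {p} (p-prime : Prime p) where

  InZ-integer : ∀ r → ℚ.denominatorℕ r ≡ 1 → InZ₍ p ₎ r
  InZ-integer r ↧r≡1 p∣↧r = ¬prime[1] (subst Prime (∣1⇒≡1 (subst (p ∣_) ↧r≡1 p∣↧r)) p-prime)

  InZ-neg : ∀ a → InZ₍ p ₎ a → InZ₍ p ₎ (ℚ.- a)
  InZ-neg a a∈ p∣↧ = a∈ (subst (p ∣_) (cong ℤ.∣_∣ (ℚP.↧-neg a)) p∣↧)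

  InZ-product : ∀ r a b → ℚ.denominatorℕ r ∣ ℚ.denominatorℕ a * ℚ.denominatorℕ b
              → InZ₍ p ₎ a → InZ₍ p ₎ b → InZ₍ p ₎ r
  InZ-product r a b ↧r∣↧a↧b a∈ b∈ p∣↧r = [ a∈ , b∈ ]′ (euclidsLemma _ _ p-prime (∣-trans p∣↧r ↧r∣↧a↧b))

  InZ-+ : ∀ a b → InZ₍ p ₎ a → InZ₍ p ₎ b → InZ₍ p ₎ (a ℚ.+ b)
  InZ-+ a b = InZ-product (a ℚ.+ b) a b (↧ₙ-+-∣ a b)

  InZ-* : ∀ a b → InZ₍ p ₎ a → InZ₍ p ₎ b → InZ₍ p ₎ (a ℚ.* b)
  InZ-* a b = InZ-product (a ℚ.* b) a b (↧ₙ-*-∣ a b)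

  IsZpPoly-+ₚ : IsZpPoly p f → IsZpPoly p g → IsZpPoly p (f +ₚ g)
  IsZpPoly-+ₚ {[]}    {g}     []         g∈         = g∈
  IsZpPoly-+ₚ {a ∷ f} {[]}    f∈         []         = f∈
  IsZpPoly-+ₚ {a ∷ f} {b ∷ g} (a∈ ∷ f∈) (b∈ ∷ g∈) = InZ-+ a b a∈ b∈ ∷ IsZpPoly-+ₚ f∈ g∈

  IsZpPoly-negₚ : IsZpPoly p f → IsZpPoly p (-ₚ f)
  IsZpPoly-negₚ f∈ = map⁺ (All.map (λ {x} → InZ-neg x) f∈)

  IsZpPoly-·ₚ : ∀ a → InZ₍ p ₎ a → IsZpPoly p f → IsZpPoly p (a ·ₚ f)
  IsZpPoly-·ₚ a a∈ f∈ = map⁺ (All.map (λ {x} → InZ-* a x a∈) f∈)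

  IsZpPoly-*ₚ : IsZpPoly p f → IsZpPoly p g → IsZpPoly p (f *ₚ g)
  IsZpPoly-*ₚ {[]}    []         g∈ = []
  IsZpPoly-*ₚ {a ∷ f} (a∈ ∷ f∈) g∈ =
    IsZpPoly-+ₚ (IsZpPoly-·ₚ a a∈ g∈) (InZ-integer 0ℚ refl ∷ IsZpPoly-*ₚ f∈ g∈)

  IsZpPoly-^ₚ : ∀ n → IsZpPoly p f → IsZpPoly p (f ^ₚ n)
  IsZpPoly-^ₚ zero    f∈ = InZ-integer 1ℚ refl ∷ []
  IsZpPoly-^ₚ (suc n) f∈ = IsZpPoly-*ₚ f∈ (IsZpPoly-^ₚ n f∈)

  IsZpPoly-qpow : ∀ k → IsZpPoly p (qpow k)
  IsZpPoly-qpow zero    = InZ-integer 1ℚ refl ∷ []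
  IsZpPoly-qpow (suc k) = InZ-integer 0ℚ refl ∷ IsZpPoly-qpow k

  IsZpPoly-sumₚ : ∀ n (F : ℕ → Poly) → (∀ j → IsZpPoly p (F j)) → IsZpPoly p (sumₚ n F)
  IsZpPoly-sumₚ zero    F F∈ = []
  IsZpPoly-sumₚ (suc n) F F∈ = IsZpPoly-+ₚ (IsZpPoly-sumₚ n F F∈) (F∈ n)

  IsZpPoly-qint-at : ∀ k n → IsZpPoly p (qint-at k n)
  IsZpPoly-qint-at k n = IsZpPoly-sumₚ n (λ i → qpow (k * i)) (λ i → IsZpPoly-qpow (k * i))

congMod : ∀ {p d h} f g → IsZpPoly p h → f -ₚ g ≋ h *ₚ d → CongMod p f g d
congMod f g h∈ (coeffwise e) = _ , h∈ , e

lemma4p1 : (p m n l α : ℕ) → Prime p → 1 ≤ m → m < p → 1 ≤ n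
         → 1 ≤ l → l < p → m * l ≡ p * α + 1
         → InvertibleZpn p n (qint m)
           × CongMod p (qint m *ₚ (qint-at m l *ₚ sumₚ n (λ j → (-ₚ (qpow 1 *ₚ qint-at p α *ₚ qint p)) ^ₚ j)))
               oneₚ (Zpn-modulus p n)
-- The range conditions only single out l and α; the congruence needs just m l = p α + 1.
lemma4p1 p m n l α p-prime _ _ _ _ _ ml≡pα+1 =
    (u , u∈ , congMod (u *ₚ qint m) oneₚ h∈ (≋-trans (+ₚ-congʳ (-ₚ oneₚ) (P.*-comm u (qint m))) [m]u-1≋h[p]ⁿ))
  , congMod (qint m *ₚ u) oneₚ h∈ [m]u-1≋h[p]ⁿ
  where
  open ℤ₍ₚ₎-Closure p-prime
  w u h : Poly
  w = qpow 1 *ₚ qint-at p α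
  u = qint-at m l *ₚ sumₚ n (λ j → (-ₚ (w *ₚ qint p)) ^ₚ j)
  h = -ₚ ((-ₚ w) ^ₚ n)

  [m]u-1≋h[p]ⁿ : qint m *ₚ u -ₚ oneₚ ≋ h *ₚ qint p ^ₚ n
  [m]u-1≋h[p]ⁿ = inverse-mod-power (qint m) (qint-at m l) w (qint p) n
    (m*l≡p*α+1⇒[m][l]≋1+q[α][p] p m l α ml≡pα+1)

  w∈ : IsZpPoly p w
  w∈ = IsZpPoly-*ₚ (IsZpPoly-qpow 1) (IsZpPoly-qint-at p α)

  u∈ : IsZpPoly p u
  u∈ = IsZpPoly-*ₚ (IsZpPoly-qint-at m l) (IsZpPoly-sumₚ n _ λ j →
    IsZpPoly-^ₚ j (IsZpPoly-negₚ (IsZpPoly-*ₚ w∈ (IsZpPoly-qint-at 1 p))))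

  h∈ : IsZpPoly p h
  h∈ = IsZpPoly-negₚ (IsZpPoly-^ₚ n (IsZpPoly-negₚ w∈))
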